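{- For positive integers $a,b,c$ with $a\le b\le c$, the Sprague–Grundy values of the Sharing Nim positions $(a,b,c)$ and $(0,b-a,c-a)$ coincide: $\mathcal{G}(a,b,c)=\mathcal{G}(0,b-a,c-a)$.
   Context: Three-pile Sharing Nim: a position is a triple of nonnegative integers (pile sizes; the order of the piles is irrelevant). A move consists of choosing a pile, taking some positive number $k$ of tokens from it and adding them to one of the other piles, provided that after the move the receiving pile does not have more tokens than the source pile. Thus from $(a,b,c)$ with $a\le b\le c$ the moves are $(a,b,c)\to(a+k,b-k,c)$ with $1\le k\le (b-a)/2$, $(a,b,c)\to(a+k,b,c-k)$ with $1\le k\le (c-a)/2$, and $(a,b,c)\to(a,b+k,c-k)$ with $1\le k\le (c-b)/2$. Players alternate; the player who cannot move loses (normal play). For a set $S$ of nonnegative integers, $\operatorname{mex}(S)$ is the least nonnegative integer not in $S$. The Sprague–Grundy value is defined recursively by $\mathcal{G}(p)=\operatorname{mex}\{\mathcal{G}(q): \text{there is a move from } p \text{ to } q\}$. -}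

module Defs where

open import Data.Nat using (ℕ; zero; suc; _+_; _*_; _∸_; _≟_)
open import Data.Nat.DivMod using (_/_)
open import Data.Product using (_×_; _,_)
open import Data.List using (List; []; _∷_; map; _++_; upTo; length; concatMap)
open import Data.List.Membership.DecPropositional _≟_ using (_∈?_)
open import Relation.Nullary using (yes; no)

-- A Sharing Nim position: three piles (as an ordered triple; the game and
-- its Grundy value do not depend on the order of the piles).
Position : Set
Position = ℕ × ℕ × ℕ

-- mex of a finite list: least natural number not occurring in the list.
-- (The answer is at most the length of the list, so  suc (length l)  search
-- steps suffice.)
mexFrom : ℕ → ℕ → List ℕ → ℕ
mexFrom zero    n l = n
mexFrom (suc f) n l with n ∈? l
... | yes _ = mexFrom f (suc n) l
... | no  _ = n

mex : List ℕ → ℕ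
mex l = mexFrom (suc (length l)) 0 l

-- amounts k with 1 ≤ k and (receiving pile) + k ≤ (source pile) - k,
-- i.e. 1 ≤ k ≤ ⌊(src - dst)/2⌋.
amounts : ℕ → ℕ → List ℕ
amounts src dst = map suc (upTo ((src ∸ dst) / 2))

moves : Position → List Position
moves (x , y , z) =
     map (λ k → (x ∸ k , y + k , z)) (amounts x y)
  ++ map (λ k → (x ∸ k , y , z + k)) (amounts x z)
  ++ map (λ k → (x + k , y ∸ k , z)) (amounts y x)
  ++ map (λ k → (x , y ∸ k , z + k)) (amounts y z)
  ++ map (λ k → (x + k , y , z ∸ k)) (amounts z x)
  ++ map (λ k → (x , y + k , z ∸ k)) (amounts z y)

grundyFuel : ℕ → Position → ℕ
grundyFuel zero    p = 0
grundyFuel (suc f) p = mex (map (grundyFuel f) (moves p))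

-- Every move strictly decreases x² + y² + z² (moving k from s to d with
-- d + k ≤ s - k lowers it by 2k(s - d - k) ≥ 2k² > 0), so a budget of
-- x² + y² + z² + 1 always suffices and grundyFuel then equals the
-- recursively defined Sprague–Grundy value 𝒢.
budget : Position → ℕ
budget (x , y , z) = suc (x * x + y * y + z * z)

𝒢 : Position → ℕ
𝒢 p = grundyFuel (budget p) p

-- Adding t tokens to every pile changes no pile difference, and the legal
-- amounts of a move depend only on the difference of the two piles involved;
-- so translation by t is an isomorphism of game graphs and preserves 𝒢.
-- Since every move strictly lowers the sum of squares of the piles, any fuel
-- beyond that sum already computes 𝒢, which reconciles the different budgets
-- of a position and its translate.
module Submission where

open import Defs
open import Data.Nat using (ℕ; zero; suc; _+_; _*_; _≤_; _<_; _∸_; z≤n; s≤s; _/_)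
open import Data.Nat.Properties
open import Data.Nat.DivMod using (m/n*n≤m)
open import Data.Nat.Tactic.RingSolver using (solve-∀)
open import Algebra.Properties.CommutativeSemigroup +-commutativeSemigroup using (xy∙z≈xz∙y)
open import Data.Product using (_,_)
open import Data.List using (List; map; _++_; upTo)
open import Data.List.Properties using (map-++; map-∘; map-cong; map-cong-local)
open import Data.List.Relation.Unary.All using (All)
import Data.List.Relation.Unary.All as All
open import Data.List.Relation.Unary.All.Properties using (map⁺; ++⁺; all-upTo)
open import Function using (_∘_)
open import Relation.Binary.PropositionalEquality

sq : ℕ → ℕ
sq n = n * n

record LegalTransfer (s d k : ℕ) : Set where
  constructor legalTransfer
  field
    positive : 1 ≤ k
    bounded  : d + (k + k) ≤ s

amounts-legal : ∀ s d → All (LegalTransfer s d) (amounts s d)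
amounts-legal s d = map⁺ (All.map legal (all-upTo ((s ∸ d) / 2)))
  where
  legal : ∀ {i} → i < (s ∸ d) / 2 → LegalTransfer s d (suc i)
  legal {i} i<q = legalTransfer (s≤s z≤n) d+2k≤s
    where
    2k≤s∸d : suc i + suc i ≤ s ∸ d
    2k≤s∸d = begin
      suc i + suc i   ≡⟨ cong (suc i +_) (+-identityʳ (suc i)) ⟨
      2 * suc i       ≡⟨ *-comm 2 (suc i) ⟩
      suc i * 2       ≤⟨ *-monoˡ-≤ 2 i<q ⟩
      (s ∸ d) / 2 * 2 ≤⟨ m/n*n≤m (s ∸ d) 2 ⟩
      s ∸ d           ∎
      where open ≤-Reasoning
    d<s : d < s
    d<s = m∸n≢0⇒n<m (>⇒≢ (≤-trans (s≤s z≤n) 2k≤s∸d))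
    d+2k≤s : d + (suc i + suc i) ≤ s
    d+2k≤s = subst (_≤ s) (+-comm (suc i + suc i) d) (m≤o∸n⇒m+n≤o _ (<⇒≤ d<s) 2k≤s∸d)

legal-≤ : ∀ {s d k} → LegalTransfer s d k → k ≤ s
legal-≤ {d = d} {k} (legalTransfer _ bound) = ≤-trans (m≤m+n k k) (≤-trans (m≤n+m (k + k) d) bound)

all-transfers : ∀ {P : Position → Set} s d (f : ℕ → Position) →
  (∀ {k} → LegalTransfer s d k → P (f k)) → All P (map f (amounts s d))
all-transfers s d f h = map⁺ (All.map h (amounts-legal s d))

-- Moving k from s to d lowers s² + d² by 2k(s − d − k) ≥ 2k²; here s = d + 2k + m.
sq-transfer-identity : ∀ d k m →
  (d + k + k + m) * (d + k + k + m) + d * d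
    ≡ (d + k + m) * (d + k + m) + (d + k) * (d + k) + 2 * k * (k + m)
sq-transfer-identity = solve-∀

transfer-decreases-sq : ∀ {s d k} → LegalTransfer s d k → sq (s ∸ k) + sq (d + k) < sq s + sq d
transfer-decreases-sq {s} {d} {suc j} (legalTransfer (s≤s z≤n) bound) = begin-strict
  sq (s ∸ k) + sq (d + k)                        ≡⟨ cong (λ n → sq (n ∸ k) + sq (d + k)) d+2k+m≡s ⟨
  sq (d + k + k + m ∸ k) + sq (d + k)            ≡⟨ cong (λ n → sq n + sq (d + k)) d+2k+m∸k≡d+k+m ⟩
  sq (d + k + m) + sq (d + k)                    <⟨ m<m+n _ (s≤s z≤n) ⟩
  sq (d + k + m) + sq (d + k) + 2 * k * (k + m)  ≡⟨ sq-transfer-identity d k m ⟨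
  sq (d + k + k + m) + sq d                      ≡⟨ cong (λ n → sq n + sq d) d+2k+m≡s ⟩
  sq s + sq d                                    ∎
  where
  open ≤-Reasoning
  k = suc j
  m = s ∸ (d + (k + k))
  d+2k+m≡s : d + k + k + m ≡ s
  d+2k+m≡s = trans (cong (_+ m) (+-assoc d k k)) (m+[n∸m]≡n bound)
  d+2k+m∸k≡d+k+m : d + k + k + m ∸ k ≡ d + k + m
  d+2k+m∸k≡d+k+m = trans (cong (_∸ k) (xy∙z≈xz∙y (d + k) k m)) (m+n∸n≡m (d + k + m) k)

transfer-decreases-sq′ : ∀ {s d k} → LegalTransfer s d k → sq (d + k) + sq (s ∸ k) < sq d + sq s
transfer-decreases-sq′ {s} {d} {k} legal =
  subst₂ _<_ (+-comm (sq (s ∸ k)) (sq (d + k))) (+-comm (sq s) (sq d)) (transfer-decreases-sq legal)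

-- Opaque so that a goal  sumSq q < sumSq p  determines q and p by unification.
opaque
  sumSq : Position → ℕ
  sumSq (x , y , z) = sq x + sq y + sq z

opaque
  unfolding sumSq

  sumSq<budget : ∀ p → sumSq p < budget p
  sumSq<budget (x , y , z) = ≤-refl

  sumSq-<₁₂ : ∀ {x y z x′ y′ : ℕ} →
    sq x′ + sq y′ < sq x + sq y → sumSq (x′ , y′ , z) < sumSq (x , y , z)
  sumSq-<₁₂ {z = z} = +-monoˡ-< (sq z)

  sumSq-<₁₃ : ∀ {x y z x′ z′ : ℕ} →
    sq x′ + sq z′ < sq x + sq z → sumSq (x′ , y , z′) < sumSq (x , y , z)
  sumSq-<₁₃ {x} {y} {z} {x′} {z′} lt =
    subst₂ _<_ (xy∙z≈xz∙y (sq x′) (sq z′) (sq y)) (xy∙z≈xz∙y (sq x) (sq z) (sq y)) (+-monoˡ-< (sq y) lt)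

  sumSq-<₂₃ : ∀ {x y z y′ z′ : ℕ} →
    sq y′ + sq z′ < sq y + sq z → sumSq (x , y′ , z′) < sumSq (x , y , z)
  sumSq-<₂₃ {x} {y} {z} {y′} {z′} lt =
    subst₂ _<_ (sym (+-assoc (sq x) (sq y′) (sq z′))) (sym (+-assoc (sq x) (sq y) (sq z))) (+-monoʳ-< (sq x) lt)

moves-decrease-sumSq : ∀ p → All (λ q → sumSq q < sumSq p) (moves p)
moves-decrease-sumSq (x , y , z) =
  ++⁺ (all-transfers x y (λ k → (x ∸ k , y + k , z)) (sumSq-<₁₂ ∘ transfer-decreases-sq)) (
  ++⁺ (all-transfers x z (λ k → (x ∸ k , y , z + k)) (sumSq-<₁₃ ∘ transfer-decreases-sq)) (
  ++⁺ (all-transfers y x (λ k → (x + k , y ∸ k , z)) (sumSq-<₁₂ ∘ transfer-decreases-sq′)) (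
  ++⁺ (all-transfers y z (λ k → (x , y ∸ k , z + k)) (sumSq-<₂₃ ∘ transfer-decreases-sq)) (
  ++⁺ (all-transfers z x (λ k → (x + k , y , z ∸ k)) (sumSq-<₁₃ ∘ transfer-decreases-sq′))
      (all-transfers z y (λ k → (x , y + k , z ∸ k)) (sumSq-<₂₃ ∘ transfer-decreases-sq′))))))

grundyFuel-stable : ∀ f g p → sumSq p < f → sumSq p < g → grundyFuel f p ≡ grundyFuel g p
grundyFuel-stable (suc f) (suc g) p (s≤s p<f) (s≤s p<g) =
  cong mex (map-cong-local (All.map (λ {q} q<p →
    grundyFuel-stable f g q (<-≤-trans q<p p<f) (<-≤-trans q<p p<g)) (moves-decrease-sumSq p)))

position-≡ : ∀ {a a′ b b′ c c′ : ℕ} → a ≡ a′ → b ≡ b′ → c ≡ c′ → (a , b , c) ≡ (a′ , b′ , c′)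
position-≡ refl refl refl = refl

translate : ℕ → Position → Position
translate t (x , y , z) = (t + x , t + y , t + z)

amounts-translate : ∀ t s d → amounts (t + s) (t + d) ≡ amounts s d
amounts-translate t s d = cong (λ n → map suc (upTo (n / 2))) ([m+n]∸[m+o]≡n∸o t s d)

map-++-≡ : ∀ {A B : Set} (f : A → B) {xs xs′ : List A} {ys ys′ : List B} →
  map f xs ≡ ys → map f xs′ ≡ ys′ → map f (xs ++ xs′) ≡ ys ++ ys′
map-++-≡ f {xs} {xs′} p q = trans (map-++ f xs xs′) (cong₂ _++_ p q)

translate-transfers : ∀ t s d (f g : ℕ → Position) →
  (∀ {k} → LegalTransfer s d k → translate t (g k) ≡ f k) →
  map (translate t) (map g (amounts s d)) ≡ map f (amounts (t + s) (t + d))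
translate-transfers t s d f g h = begin
  map (translate t) (map g (amounts s d))  ≡⟨ map-∘ (amounts s d) ⟨
  map (translate t ∘ g) (amounts s d)      ≡⟨ map-cong-local (All.map h (amounts-legal s d)) ⟩
  map f (amounts s d)                      ≡⟨ cong (map f) (amounts-translate t s d) ⟨
  map f (amounts (t + s) (t + d))          ∎
  where open ≡-Reasoning

moves-translate : ∀ t p → map (translate t) (moves p) ≡ moves (translate t p)
moves-translate t (x , y , z) =
  map-++-≡ (translate t) (translate-transfers t x y _ _ λ l → position-≡ (lower l) raise refl) (
  map-++-≡ (translate t) (translate-transfers t x z _ _ λ l → position-≡ (lower l) refl raise) (
  map-++-≡ (translate t) (translate-transfers t y x _ _ λ l → position-≡ raise (lower l) refl) (
  map-++-≡ (translate t) (translate-transfers t y z _ _ λ l → position-≡ refl (lower l) raise) (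
  map-++-≡ (translate t) (translate-transfers t z x _ _ λ l → position-≡ raise refl (lower l))
                         (translate-transfers t z y _ _ λ l → position-≡ refl raise (lower l))))))
  where
  lower : ∀ {u d k} → LegalTransfer u d k → t + (u ∸ k) ≡ t + u ∸ k
  lower l = sym (+-∸-assoc t (legal-≤ l))
  raise : ∀ {u k} → t + (u + k) ≡ t + u + k
  raise {u} {k} = sym (+-assoc t u k)

grundyFuel-translate : ∀ f t p → grundyFuel f (translate t p) ≡ grundyFuel f p
grundyFuel-translate zero    t p = refl
grundyFuel-translate (suc f) t p = cong mex (begin
  map (grundyFuel f) (moves (translate t p))            ≡⟨ cong (map (grundyFuel f)) (moves-translate t p) ⟨
  map (grundyFuel f) (map (translate t) (moves p))      ≡⟨ map-∘ (moves p) ⟨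
  map (grundyFuel f ∘ translate t) (moves p)            ≡⟨ map-cong (grundyFuel-translate f t) (moves p) ⟩
  map (grundyFuel f) (moves p)                          ∎)
  where open ≡-Reasoning

opaque
  unfolding sumSq

  sumSq-translate-≤ : ∀ t p → sumSq p ≤ sumSq (translate t p)
  sumSq-translate-≤ t (x , y , z) = +-mono-≤ (+-mono-≤ (sq-≤ x) (sq-≤ y)) (sq-≤ z)
    where
    sq-≤ : ∀ u → sq u ≤ sq (t + u)
    sq-≤ u = *-mono-≤ (m≤n+m u t) (m≤n+m u t)

𝒢-translate : ∀ t p → 𝒢 (translate t p) ≡ 𝒢 p
𝒢-translate t p = begin
  grundyFuel (budget (translate t p)) (translate t p)  ≡⟨ grundyFuel-translate (budget (translate t p)) t p ⟩
  grundyFuel (budget (translate t p)) p                ≡⟨ grundyFuel-stable _ (budget p) p enough (sumSq<budget p) ⟩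
  grundyFuel (budget p) p                              ∎
  where
  open ≡-Reasoning
  enough : sumSq p < budget (translate t p)
  enough = ≤-<-trans (sumSq-translate-≤ t p) (sumSq<budget (translate t p))

mainTheorem1 : (a b c : ℕ) → 1 ≤ a → a ≤ b → b ≤ c →
    𝒢 (a , b , c) ≡ 𝒢 (0 , b ∸ a , c ∸ a)
mainTheorem1 a b c _ a≤b b≤c = begin
  𝒢 (a , b , c)                        ≡⟨ cong 𝒢 (position-≡ (+-identityʳ a) (m+[n∸m]≡n a≤b) (m+[n∸m]≡n a≤c)) ⟨
  𝒢 (translate a (0 , b ∸ a , c ∸ a))  ≡⟨ 𝒢-translate a (0 , b ∸ a , c ∸ a) ⟩
  𝒢 (0 , b ∸ a , c ∸ a)                ∎
  where
  open ≡-Reasoning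
  a≤c : a ≤ c
  a≤c = ≤-trans a≤b b≤c
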